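{- Let $d\ge2$, $k\ge1$, let $\Gamma$ be a subtree of $T_k$, and let $D_\Gamma$ be the $\mathcal D$-class of $\mathrm{PAut}_c(T_k)$ consisting of all $\sigma$ with $\mathrm{dom}(\sigma)\cong\Gamma$. Then the number of $\mathcal R$-classes and the number of $\mathcal L$-classes contained in $D_\Gamma$ are both equal to $$\frac{(d!)^{\frac{1-d^k}{1-d}}}{|St_{T_k}(\Gamma)|}.$$
   Context: $T_k$ is the rooted $k$-level $d$-regular tree (root at level 0, every vertex at level $<k$ has exactly $d$ children). A subtree means a connected subgraph containing the root. $\mathrm{PAut}_c(T_k)$ is the semigroup of injective partial maps $\varphi$ of the vertex set of $T_k$ that are graph isomorphisms between the subgraphs induced on domain and range, whose domain induces a connected subgraph containing the root, and which preserve vertex levels; composition is $(\varphi\psi)(x)=\psi(\varphi(x))$. $\mathrm{dom}(\sigma)\cong\Gamma$ means isomorphism as rooted trees. $St_{T_k}(\Gamma)$ is the setwise stabilizer of $\Gamma$ in $\mathrm{Aut}\,T_k$. $\mathcal L,\mathcal R,\mathcal D$ are Green's relations. -}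

module Defs where

open import Data.Nat.Base using (ℕ; zero; suc; _+_; _*_; _^_; _≤_; _!)
open import Data.Fin.Base using (Fin)
open import Data.Maybe.Base using (Maybe; just; nothing; is-just; _>>=_)
open import Data.Bool.Base using (Bool; true; false)
open import Data.Product.Base using (Σ; _×_; _,_)
open import Data.Sum.Base using (_⊎_)
open import Relation.Binary.PropositionalEquality using (_≡_)

-- A vertex of T_k is a word over the alphabet Fin d of length ≤ k:
-- `root` is the empty word, `a ∷ w` is the word starting with letter a
-- (go to child a of the root, then follow w).

data Vert (d : ℕ) : ℕ → Set where
  root : ∀ {k} → Vert d k
  _∷_  : ∀ {k} → Fin d → Vert d k → Vert d (suc k)

level : ∀ {d k} → Vert d k → ℕ
level root    = 0
level (a ∷ w) = suc (level w)

data Child {d : ℕ} : ∀ {k} → Vert d k → Vert d k → Set where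
  top  : ∀ {k} (a : Fin d) → Child {k = suc k} root (a ∷ root)
  step : ∀ {k} (a : Fin d) {x y : Vert d k} → Child x y → Child (a ∷ x) (a ∷ y)

Adj : ∀ {d k} → Vert d k → Vert d k → Set
Adj x y = Child x y ⊎ Child y x

_⇔_ : Set → Set → Set
A ⇔ B = (A → B) × (B → A)

VSet : ℕ → ℕ → Set
VSet d k = Vert d k → Bool

_∈_ : ∀ {d k} → Vert d k → VSet d k → Set
x ∈ S = S x ≡ true

-- A subtree (connected subgraph containing the root) of the rooted tree
-- T_k, given by its vertex set: contains the root and is closed under
-- taking parents.
IsSubtree : ∀ {d k} → VSet d k → Set
IsSubtree {d} {k} S = (root ∈ S) × (∀ (x y : Vert d k) → Child x y → y ∈ S → x ∈ S)

RootedIso : ∀ {d k} → VSet d k → VSet d k → Set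
RootedIso {d} {k} A B =
  Σ (Vert d k → Vert d k) λ h → Σ (Vert d k → Vert d k) λ g →
    (∀ x → x ∈ A → h x ∈ B) ×
    (∀ y → y ∈ B → g y ∈ A) ×
    (∀ x → x ∈ A → g (h x) ≡ x) ×
    (∀ y → y ∈ B → h (g y) ≡ y) ×
    (h root ≡ root) ×
    (∀ x y → x ∈ A → y ∈ A → Child x y ⇔ Child (h x) (h y))

PMap : ℕ → ℕ → Set
PMap d k = Vert d k → Maybe (Vert d k)

dom : ∀ {d k} → PMap d k → VSet d k
dom φ x = is-just (φ x)

IsPAutc : ∀ {d k} → PMap d k → Set
IsPAutc {d} {k} φ =
  IsSubtree (dom φ) ×
  (∀ x y z → φ x ≡ just z → φ y ≡ just z → x ≡ y) ×
  (∀ x y → φ x ≡ just y → level y ≡ level x) ×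
  (∀ x y x' y' → φ x ≡ just x' → φ y ≡ just y' → Adj x y ⇔ Adj x' y')

-- composition (φψ)(x) = ψ(φ(x))
_·_ : ∀ {d k} → PMap d k → PMap d k → PMap d k
(φ · ψ) x = φ x >>= ψ

_≈_ : ∀ {d k} → PMap d k → PMap d k → Set
φ ≈ ψ = ∀ x → φ x ≡ ψ x

-- Green's relations in S = PAut_c(T_k) (using S¹).
-- σ R τ  iff  σS¹ = τS¹
GreenR : ∀ {d k} → PMap d k → PMap d k → Set
GreenR {d} {k} σ τ =
  (σ ≈ τ ⊎ Σ (PMap d k) (λ α → IsPAutc α × (σ ≈ (τ · α)))) ×
  (τ ≈ σ ⊎ Σ (PMap d k) (λ β → IsPAutc β × (τ ≈ (σ · β))))

-- σ L τ  iff  S¹σ = S¹τ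
GreenL : ∀ {d k} → PMap d k → PMap d k → Set
GreenL {d} {k} σ τ =
  (σ ≈ τ ⊎ Σ (PMap d k) (λ α → IsPAutc α × (σ ≈ (α · τ)))) ×
  (τ ≈ σ ⊎ Σ (PMap d k) (λ β → IsPAutc β × (τ ≈ (β · σ))))

DClass : ∀ {d k} → VSet d k → PMap d k → Set
DClass Γ σ = IsPAutc σ × RootedIso (dom σ) Γ

IsAut : ∀ {d k} → (Vert d k → Vert d k) → Set
IsAut {d} {k} f =
  Σ (Vert d k → Vert d k) λ g →
    (∀ x → g (f x) ≡ x) × (∀ x → f (g x) ≡ x) ×
    (∀ x y → Child x y ⇔ Child (f x) (f y))

Stab : ∀ {d k} → VSet d k → (Vert d k → Vert d k) → Set
Stab Γ f = IsAut f × (∀ x → Γ (f x) ≡ Γ x)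

_≗_ : ∀ {d k} → (Vert d k → Vert d k) → (Vert d k → Vert d k) → Set
f ≗ g = ∀ x → f x ≡ g x

-- Counting: "the number of E-classes of elements satisfying P is n",
-- witnessed by a complete system of pairwise non-equivalent representatives.

record Count {A : Set} (P : A → Set) (E : A → A → Set) (n : ℕ) : Set where
  field
    rep          : Fin n → A
    rep-in       : ∀ i → P (rep i)
    rep-distinct : ∀ i j → E (rep i) (rep j) → i ≡ j
    rep-cover    : ∀ x → P x → Σ (Fin n) λ i → E x (rep i)

-- geom d k = 1 + d + … + d^(k-1) = (1 - d^k)/(1 - d)
geom : ℕ → ℕ → ℕ
geom d zero    = 0
geom d (suc k) = geom d k + d ^ k

-- Automorphisms of T_k are enumerated by Fin ((d!)^(1+d+…+d^(k-1))):
-- a permutation of the children of the root together with, recursively, an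
-- automorphism of the branch below each child.  Every rooted embedding of a
-- subtree into T_k extends to an automorphism, so the subtrees isomorphic to Γ are
-- exactly the images of Γ under automorphisms, and orbit–stabilizer gives
-- (number of images) · |St(Γ)| = |Aut T_k|.  In D_Γ, σ is R-related to the partial
-- identity on dom σ and L-related to the partial identity on its range, and two
-- partial identities are R- or L-related only when they are equal; so the images
-- of Γ index both the R-classes and the L-classes of D_Γ.

module Submission where

open import Defs
open import Data.Nat.Base using (ℕ; zero; suc; _+_; _*_; _^_; _≤_; _!)
open import Data.Fin.Base using (Fin; zero; suc; finToFun; funToFin; remainder; punchIn; punchOut; Fin′; inject; fromℕ<; combine; remQuot; _<_)
open import Data.Fin.Properties
  using (_≟_; finToFun-funToFin; punchIn-injective; punchIn-punchOut; punchOut-cong; combine-surjective; any?; ¬∀⟶∃¬; suc-injective; all?; toℕ-injective; toℕ-inject; toℕ-fromℕ<; <-cmp; remQuot-combine; combine-remQuot; injective⇒≤; ¬∀⟶∃¬-smallest)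
open import Data.Fin.Permutation as P using (Permutation′; _⟨$⟩ʳ_; _⟨$⟩ˡ_)
open import Data.Product.Base using (Σ; ∃; ∃₂; _×_; _,_; proj₁; proj₂; uncurry; swap)
open import Data.Empty using (⊥-elim)
open import Data.Bool.Base using (true; false; if_then_else_)
import Data.Bool.Properties as Bool
open import Data.Sum.Base using (_⊎_; inj₁; inj₂)
open import Data.Maybe.Base using (Maybe; just; nothing; _>>=_; is-just; fromMaybe)
open import Data.Maybe.Properties using (just-injective; ≡-dec)
open import Level using (0ℓ)
open import Relation.Binary.Core using (Rel)
open import Relation.Binary.Definitions using (tri<; tri≈; tri>; DecidableEquality)
open import Relation.Binary.Structures using (IsDecEquivalence)
open import Relation.Unary using (Pred; Decidable; U)
open import Relation.Nullary using (¬_; Dec; yes; no; ¬?)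
open import Relation.Nullary.Decidable using (decidable-stable; _×-dec_; _⊎-dec_)
import Relation.Nullary.Decidable as Dec
open import Relation.Binary.PropositionalEquality using (_≡_; _≢_; refl; sym; trans; cong; cong₂; subst; subst₂; module ≡-Reasoning)
import Data.Nat.Properties as ℕ
open ≡-Reasoning

open Count

count-unique : ∀ {A : Set} {P : A → Set} {E : A → A → Set} {a b} →
  (∀ {x y} → E x y → E y x) → (∀ {x y z} → E x y → E y z → E x z) →
  Count P E a → Count P E b → a ≡ b
count-unique {P = P} {E} sym-E trans-E CA CB =
  ℕ.≤-antisym (injective⇒≤ (classify-injective CA CB)) (injective⇒≤ (classify-injective CB CA))
  where
  classify-injective : ∀ {a b} (X : Count P E a) (Y : Count P E b) {i j} →
    proj₁ (rep-cover Y (rep X i) (rep-in X i)) ≡ proj₁ (rep-cover Y (rep X j) (rep-in X j)) → i ≡ j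
  classify-injective X Y {i} {j} same =
    rep-distinct X i j (trans-E (proj₂ cover-i) (subst (λ t → E (rep Y t) (rep X j)) (sym same) (sym-E (proj₂ cover-j))))
    where
    cover-i = rep-cover Y (rep X i) (rep-in X i)
    cover-j = rep-cover Y (rep X j) (rep-in X j)

module _ {N m} {P : Pred (Fin (suc N)) 0ℓ} (C : Count (λ i → P (suc i)) _≡_ m) where

  count-skip : ¬ P zero → Count P _≡_ m
  count-skip ¬P₀ = record
    { rep          = λ t → suc (rep C t)
    ; rep-in       = rep-in C
    ; rep-distinct = λ t t′ e → rep-distinct C t t′ (suc-injective e)
    ; rep-cover    = cover }
    where
    cover : ∀ i → P i → Σ (Fin m) λ t → i ≡ suc (rep C t)
    cover zero    P₀ = ⊥-elim (¬P₀ P₀)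
    cover (suc i) Pi with t , refl ← rep-cover C i Pi = t , refl

  count-keep : P zero → Count P _≡_ (suc m)
  count-keep P₀ = record
    { rep          = rep′
    ; rep-in       = λ { zero → P₀ ; (suc t) → rep-in C t }
    ; rep-distinct = distinct
    ; rep-cover    = cover }
    where
    rep′ : Fin (suc m) → Fin (suc N)
    rep′ zero    = zero
    rep′ (suc t) = suc (rep C t)
    distinct : ∀ t t′ → rep′ t ≡ rep′ t′ → t ≡ t′
    distinct zero    zero     _    = refl
    distinct (suc t) (suc t′) e = cong suc (rep-distinct C t t′ (suc-injective e))
    cover : ∀ i → P i → Σ (Fin (suc m)) λ t → i ≡ rep′ t
    cover zero    _  = zero , refl
    cover (suc i) Pi with t , refl ← rep-cover C i Pi = suc t , refl

count-decidable : ∀ {N} {P : Pred (Fin N) 0ℓ} → Decidable P → Σ ℕ (Count P _≡_)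
count-decidable {zero}  P? = 0 , record { rep = λ () ; rep-in = λ () ; rep-distinct = λ () ; rep-cover = λ () }
count-decidable {suc N} P? with m , C ← count-decidable (λ i → P? (suc i)) | P? zero
... | yes P₀ = suc m , count-keep C P₀
... | no ¬P₀ = m , count-skip C ¬P₀

inject-fromℕ< : ∀ {N} {i j : Fin N} (i<j : i < j) → inject {i = j} (fromℕ< i<j) ≡ i
inject-fromℕ< i<j = toℕ-injective (trans (toℕ-inject (fromℕ< i<j)) (toℕ-fromℕ< i<j))

-- Each class is represented by its least element.
module _ {N} {_~_ : Rel (Fin N) 0ℓ} (~-isDecEquivalence : IsDecEquivalence _~_) where
  open IsDecEquivalence ~-isDecEquivalence using () renaming (_≟_ to _~?_; refl to ~-refl; sym to ~-sym; trans to ~-trans)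

  Least : Pred (Fin N) 0ℓ
  Least i = (j : Fin′ i) → ¬ inject j ~ i

  least-unique : ∀ {i j} → Least i → Least j → i ~ j → i ≡ j
  least-unique {i} {j} least-i least-j i~j with <-cmp i j
  ... | tri< i<j _ _ = ⊥-elim (least-j (fromℕ< i<j) (subst (_~ j) (sym (inject-fromℕ< i<j)) i~j))
  ... | tri≈ _ i≡j _ = i≡j
  ... | tri> _ _ j<i = ⊥-elim (least-i (fromℕ< j<i) (subst (_~ i) (sym (inject-fromℕ< j<i)) (~-sym i~j)))

  least-exists : ∀ i → ∃ λ j → Least j × i ~ j
  least-exists i
    with j , ¬¬j~i , smaller≁i ← ¬∀⟶∃¬-smallest N (λ j → ¬ j ~ i) (λ j → ¬? (j ~? i)) (λ all → all i ~-refl)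
    = j , (λ l l~j → smaller≁i l (~-trans l~j (decidable-stable (j ~? i) ¬¬j~i))) , ~-sym (decidable-stable (j ~? i) ¬¬j~i)

  count-classes : Σ ℕ (Count U _~_)
  count-classes with n , C ← count-decidable (λ i → all? (λ j → ¬? (inject j ~? i))) = n , record
    { rep          = rep C
    ; rep-in       = λ _ → _
    ; rep-distinct = λ t t′ r~r′ → rep-distinct C t t′ (least-unique (rep-in C t) (rep-in C t′) r~r′)
    ; rep-cover    = cover }
    where
    cover : ∀ i → U i → Σ _ λ t → i ~ rep C t
    cover i _ with j , least-j , i~j ← least-exists i with t , refl ← rep-cover C j least-j = t , i~j

count-pairs : ∀ {A : Set} {P : A → Set} {E : A → A → Set} {a b} (f : Fin a → Fin b → A) →
  (∀ i j → P (f i j)) →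
  (∀ i j i′ j′ → E (f i j) (f i′ j′) → i ≡ i′ × j ≡ j′) →
  (∀ x → P x → ∃₂ λ i j → E x (f i j)) →
  Count P E (a * b)
count-pairs {P = P} {E} {a} {b} f f-in f-distinct f-cover = record
  { rep          = rep′
  ; rep-in       = λ ij → f-in _ _
  ; rep-distinct = distinct
  ; rep-cover    = cover }
  where
  rep′ : Fin (a * b) → _
  rep′ ij = f (proj₁ (remQuot {a} b ij)) (proj₂ (remQuot {a} b ij))
  distinct : ∀ ij ij′ → E (rep′ ij) (rep′ ij′) → ij ≡ ij′
  distinct ij ij′ e with i≡i′ , j≡j′ ← f-distinct _ _ _ _ e =
    trans (sym (combine-remQuot {a} b ij)) (trans (cong₂ combine i≡i′ j≡j′) (combine-remQuot {a} b ij′))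
  cover : ∀ x → P x → Σ (Fin (a * b)) λ ij → E x (rep′ ij)
  cover x Px with i , j , x~ij ← f-cover x Px =
    combine i j , subst (λ r → E x (f (proj₁ r) (proj₂ r))) (sym (remQuot-combine i j)) x~ij

perm : ∀ n → Fin (n !) → Permutation′ n
perm zero    _ = P.id
perm (suc n) c = P.insert zero (proj₁ (remQuot {suc n} (n !) c)) (perm n (proj₂ (remQuot {suc n} (n !) c)))

perm-combine : ∀ n (i : Fin (suc n)) c x → perm (suc n) (combine i c) ⟨$⟩ʳ x ≡ P.insert zero i (perm n c) ⟨$⟩ʳ x
perm-combine n i c x = cong (λ r → P.insert zero (proj₁ r) (perm n (proj₂ r)) ⟨$⟩ʳ x) (remQuot-combine i c)

perm-suc : ∀ n (i : Fin (suc n)) c j → perm (suc n) (combine i c) ⟨$⟩ʳ suc j ≡ punchIn i (perm n c ⟨$⟩ʳ j)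
perm-suc n i c j = trans (perm-combine n i c (suc j)) (P.insert-punchIn zero i (perm n c) j)

perm-injective : ∀ n c c′ → (∀ x → perm n c ⟨$⟩ʳ x ≡ perm n c′ ⟨$⟩ʳ x) → c ≡ c′
perm-injective zero    zero zero _ = refl
perm-injective (suc n) c c′ same
  with i , d , refl ← combine-surjective {suc n} {n !} c | i′ , d′ , refl ← combine-surjective {suc n} {n !} c′
  with refl ← trans (sym (perm-combine n i d zero)) (trans (same zero) (perm-combine n i′ d′ zero))
  = cong (combine i) (perm-injective n d d′ λ j →
      punchIn-injective i _ _ (trans (sym (perm-suc n i d j)) (trans (same (suc j)) (perm-suc n i d′ j))))

PartialInjection : ∀ {n} → (Fin n → Maybe (Fin n)) → Set
PartialInjection ρ = ∀ {a a′ b} → ρ a ≡ just b → ρ a′ ≡ just b → a ≡ a′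

-- If every value were taken, choosing preimages would inject Fin (suc n) into Fin n.
missed-value : ∀ {n} (σ : Fin n → Maybe (Fin (suc n))) → ∃ λ i → ∀ j → σ j ≢ just i
missed-value {n} σ with any? (λ i → all? (λ j → ¬? (≡-dec _≟_ (σ j) (just i))))
... | yes missed = missed
... | no  none   = ⊥-elim (ℕ.1+n≰n (injective⇒≤ preimage-injective))
  where
  preimage : ∀ i → ∃ λ j → ¬ ¬ σ j ≡ just i
  preimage i = ¬∀⟶∃¬ n _ (λ j → ¬? (≡-dec _≟_ (σ j) (just i))) (λ missed → none (i , missed))
  hit : ∀ i → σ (proj₁ (preimage i)) ≡ just i
  hit i = decidable-stable (≡-dec _≟_ _ _) (proj₂ (preimage i))
  preimage-injective : ∀ {i i′} → proj₁ (preimage i) ≡ proj₁ (preimage i′) → i ≡ i′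
  preimage-injective {i} {i′} same = just-injective (trans (sym (hit i)) (trans (cong σ same) (hit i′)))

punchOut? : ∀ {n} → Fin (suc n) → Fin (suc n) → Maybe (Fin n)
punchOut? i b with i ≟ b
... | yes _   = nothing
... | no i≢b = just (punchOut i≢b)

punchOut?-≢ : ∀ {n} {i b : Fin (suc n)} (i≢b : i ≢ b) → punchOut? i b ≡ just (punchOut i≢b)
punchOut?-≢ {i = i} {b} i≢b with i ≟ b
... | yes i≡b  = ⊥-elim (i≢b i≡b)
... | no  i≢b′ = cong just (punchOut-cong i refl)

punchOut?-just : ∀ {n} {i b : Fin (suc n)} {b′} → punchOut? i b ≡ just b′ → punchIn i b′ ≡ b
punchOut?-just {i = i} {b} e with i ≟ b
punchOut?-just () | yes _
punchOut?-just refl | no i≢b = punchIn-punchOut i≢b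

>>=-just : ∀ {A B : Set} (m : Maybe A) {f : A → Maybe B} {y} → (m >>= f) ≡ just y → ∃ λ x → m ≡ just x × f x ≡ just y
>>=-just (just x) e = x , refl , e

module _ {n} (ρ : Fin (suc n) → Maybe (Fin (suc n))) where

  pivot : PartialInjection ρ → ∃ λ i → (∀ {b} → ρ zero ≡ just b → i ≡ b) × (∀ j → ρ (suc j) ≢ just i)
  pivot ρ-injective with ρ zero in ρ0
  ... | just i  = i , (λ { refl → refl }) , λ j ρj≡i → 0≢suc (ρ-injective ρ0 ρj≡i)
    where
    0≢suc : ∀ {j : Fin n} → zero ≢ suc j
    0≢suc ()
  ... | nothing with i , unused ← missed-value (λ j → ρ (suc j)) = i , (λ ()) , unused

  avoiding : Fin (suc n) → Fin n → Maybe (Fin n)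
  avoiding i j = ρ (suc j) >>= punchOut? i

  avoiding-injective : PartialInjection ρ → ∀ i → PartialInjection (avoiding i)
  avoiding-injective ρ-injective i {j} {j′} e e′
    with b , ρj≡b , out ← >>=-just (ρ (suc j)) e | b′ , ρj′≡b′ , out′ ← >>=-just (ρ (suc j′)) e′
    = suc-injective (ρ-injective ρj≡b (trans ρj′≡b′ (cong just (trans (sym (punchOut?-just out′)) (punchOut?-just out)))))

perm-extends : ∀ n (ρ : Fin n → Maybe (Fin n)) → PartialInjection ρ →
  ∃ λ c → ∀ {a b} → ρ a ≡ just b → perm n c ⟨$⟩ʳ a ≡ b
perm-extends zero    ρ ρ-injective = zero , λ { {()} }
perm-extends (suc n) ρ ρ-injective
  with i , i-at-zero , i-unused ← pivot ρ ρ-injective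
  with c , c-extends ← perm-extends n (avoiding ρ i) (avoiding-injective ρ ρ-injective i)
  = combine i c , extends
  where
  extends : ∀ {a b} → ρ a ≡ just b → perm (suc n) (combine i c) ⟨$⟩ʳ a ≡ b
  extends {zero}  ρ0≡b = trans (perm-combine n i c zero) (i-at-zero ρ0≡b)
  extends {suc j} {b} ρj≡b = begin
    perm (suc n) (combine i c) ⟨$⟩ʳ suc j ≡⟨ perm-suc n i c j ⟩
    punchIn i (perm n c ⟨$⟩ʳ j)           ≡⟨ cong (punchIn i) (c-extends (trans (cong (_>>= punchOut? i) ρj≡b) (punchOut?-≢ i≢b))) ⟩
    punchIn i (punchOut i≢b)              ≡⟨ punchIn-punchOut i≢b ⟩
    b                                     ∎
    where
    i≢b : i ≢ b
    i≢b refl = i-unused j ρj≡b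

finToFun-injective : ∀ m n (q q′ : Fin (m ^ n)) → (∀ j → finToFun {m} {n} q j ≡ finToFun q′ j) → q ≡ q′
finToFun-injective m zero    zero zero _ = refl
finToFun-injective m (suc n) q q′ same = begin
  q                                                                     ≡⟨ combine-remQuot {m} (m ^ n) q ⟨
  combine {m} (finToFun {m} {suc n} q zero) (remainder {m} (m ^ n) q)   ≡⟨ cong₂ (combine {m}) (same zero) remainders ⟩
  combine {m} (finToFun {m} {suc n} q′ zero) (remainder {m} (m ^ n) q′) ≡⟨ combine-remQuot {m} (m ^ n) q′ ⟩
  q′                                                                    ∎
  where
  remainders : remainder {m} (m ^ n) q ≡ remainder {m} (m ^ n) q′
  remainders = finToFun-injective m n _ _ (λ j → same (suc j))

module Tree (d : ℕ) where

  private variable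
    k : ℕ
    a b : Fin d
    x y : Vert d k

  ∷-injective : _≡_ {A = Vert d (suc k)} (a ∷ x) (b ∷ y) → a ≡ b × x ≡ y
  ∷-injective refl = refl , refl

  -- Junk value at the root; only applied to non-root vertices.
  tail : Vert d (suc k) → Vert d k
  tail root    = root
  tail (_ ∷ w) = w

  child-level : Child x y → level y ≡ suc (level x)
  child-level (top a)    = refl
  child-level (step a c) = cong suc (child-level c)

  parent-unique : ∀ {x′ : Vert d k} → Child x y → Child x′ y → x ≡ x′
  parent-unique (top a)    (top .a)    = refl
  parent-unique (step a c) (step .a c′) = cong (a ∷_) (parent-unique c c′)

  parent-exists : ∀ (a : Fin d) (w : Vert d k) → ∃ λ p → Child p (a ∷ w)
  parent-exists a root    = root , top a
  parent-exists a (b ∷ w) with p , c ← parent-exists b w = a ∷ p , step a c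

  has-parent : ∀ {k n} {y : Vert d k} → level y ≡ suc n → ∃ λ p → Child p y
  has-parent {y = a ∷ w} _ = parent-exists a w

  root-parentless : ¬ Child x root
  root-parentless ()

  child-root : Child root y → ∃ λ a → y ≡ a ∷ root
  child-root (top a) = a , refl

  child-branch : Child (a ∷ x) y → y ≡ a ∷ tail y
  child-branch (step a c) = refl

  child-tail : Child {k = suc k} (a ∷ x) (b ∷ y) → Child x y
  child-tail (step a c) = c

  level≡0 : level x ≡ 0 → x ≡ root
  level≡0 {x = root} _ = refl

  adj⇒child : Adj x y → level y ≡ suc (level x) → Child x y
  adj⇒child (inj₁ xy) _ = xy
  adj⇒child {x = x} (inj₂ yx) ly = ⊥-elim (ℕ.m≢1+n+m (level x) {1} (trans (child-level yx) (cong suc ly)))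

  path-induction : (P : Vert d k → Set) → P root → (∀ {x y} → Child x y → P x → P y) → ∀ w → P w
  path-induction P P-root P-step root    = P-root
  path-induction {suc k} P P-root P-step (a ∷ w) =
    path-induction (λ u → P (a ∷ u)) (P-step (top a) P-root) (λ c → P-step (step a c)) w

  _≟ᵥ_ : DecidableEquality (Vert d k)
  root    ≟ᵥ root    = yes refl
  root    ≟ᵥ (b ∷ y) = no λ ()
  (a ∷ x) ≟ᵥ root    = no λ ()
  (a ∷ x) ≟ᵥ (b ∷ y) = Dec.map′ (λ { (refl , refl) → refl }) ∷-injective ((a ≟ b) ×-dec (x ≟ᵥ y))

  all-vertices? : ∀ {P : Vert d k → Set} → Decidable P → Dec (∀ x → P x)
  all-vertices? {zero}  P? = Dec.map′ (λ { P-root root → P-root }) (λ all → all root) (P? root)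
  all-vertices? {suc k} P? =
    Dec.map′ (λ { (P-root , P-branch) root → P-root ; (P-root , P-branch) (a ∷ w) → P-branch a w })
             (λ all → all root , λ a w → all (a ∷ w))
             (P? root ×-dec all? (λ a → all-vertices? (λ w → P? (a ∷ w))))

  any-vertex? : ∀ {P : Vert d k → Set} → Decidable P → Dec (∃ P)
  any-vertex? {zero}  P? = Dec.map′ (root ,_) (λ { (root , P-root) → P-root }) (P? root)
  any-vertex? {suc k} P? =
    Dec.map′ (λ { (inj₁ P-root) → root , P-root ; (inj₂ (a , w , P-aw)) → a ∷ w , P-aw })
             (λ { (root , P-root) → inj₁ P-root ; (a ∷ w , P-aw) → inj₂ (a , w , P-aw) })
             (P? root ⊎-dec any? (λ a → any-vertex? (λ w → P? (a ∷ w))))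

  autCount : ℕ → ℕ
  autCount zero    = 1
  autCount (suc k) = d ! * autCount k ^ d

  root-perm : Fin (autCount (suc k)) → Permutation′ d
  root-perm {k} c = perm d (proj₁ (remQuot {d !} (autCount k ^ d) c))

  branch : Fin (autCount (suc k)) → Fin d → Fin (autCount k)
  branch {k} c = finToFun (proj₂ (remQuot {d !} (autCount k ^ d) c))

  encode : Fin (d !) → (Fin d → Fin (autCount k)) → Fin (autCount (suc k))
  encode p q = combine p (funToFin q)

  aut : Fin (autCount k) → Vert d k → Vert d k
  aut c root    = root
  aut {suc k} c (a ∷ w) = (root-perm {k} c ⟨$⟩ʳ a) ∷ aut (branch {k} c a) w

  aut⁻¹ : Fin (autCount k) → Vert d k → Vert d k
  aut⁻¹ c root    = root
  aut⁻¹ {suc k} c (b ∷ w) = (root-perm {k} c ⟨$⟩ˡ b) ∷ aut⁻¹ (branch {k} c (root-perm {k} c ⟨$⟩ˡ b)) w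

  aut-encode : ∀ {k} p (q : Fin d → Fin (autCount k)) a (w : Vert d k) →
    aut (encode {k} p q) (a ∷ w) ≡ (perm d p ⟨$⟩ʳ a) ∷ aut (q a) w
  aut-encode {k} p q a w = cong₂ (λ r (b : Fin (autCount k)) → (perm d (proj₁ r) ⟨$⟩ʳ a) ∷ aut b w)
    (remQuot-combine {d !} {autCount k ^ d} p (funToFin q))
    (trans (cong (λ r → finToFun {autCount k} {d} (proj₂ r) a) (remQuot-combine {d !} {autCount k ^ d} p (funToFin q))) (finToFun-funToFin q a))

  aut⁻¹-aut : ∀ {k} (c : Fin (autCount k)) (x : Vert d k) → aut⁻¹ c (aut c x) ≡ x
  aut⁻¹-aut c root    = refl
  aut⁻¹-aut {suc k} c (a ∷ w) rewrite P.inverseˡ (root-perm {k} c) {a} = cong (a ∷_) (aut⁻¹-aut (branch {k} c a) w)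

  aut-aut⁻¹ : ∀ {k} (c : Fin (autCount k)) (y : Vert d k) → aut c (aut⁻¹ c y) ≡ y
  aut-aut⁻¹ c root    = refl
  aut-aut⁻¹ {suc k} c (b ∷ w) rewrite P.inverseʳ (root-perm {k} c) {b} = cong (b ∷_) (aut-aut⁻¹ _ w)

  aut-child : ∀ {k} (c : Fin (autCount k)) {x y : Vert d k} → Child x y → Child (aut c x) (aut c y)
  aut-child c (top a)     = top _
  aut-child {suc k} c (step a xy) = step _ (aut-child (branch {k} c a) xy)

  aut⁻¹-child : ∀ {k} (c : Fin (autCount k)) {x y : Vert d k} → Child x y → Child (aut⁻¹ c x) (aut⁻¹ c y)
  aut⁻¹-child c (top b)     = top _
  aut⁻¹-child c (step b xy) = step _ (aut⁻¹-child _ xy)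

  aut-injective : ∀ {k} (c c′ : Fin (autCount k)) → (∀ (x : Vert d k) → aut c x ≡ aut c′ x) → c ≡ c′
  aut-injective {zero}  zero zero _ = refl
  aut-injective {suc k} c c′ same = begin
    c                                                   ≡⟨ combine-remQuot {d !} (autCount k ^ d) c ⟨
    uncurry combine (remQuot {d !} (autCount k ^ d) c)  ≡⟨ cong₂ combine same-root-perm same-branches ⟩
    uncurry combine (remQuot {d !} (autCount k ^ d) c′) ≡⟨ combine-remQuot {d !} (autCount k ^ d) c′ ⟩
    c′                                                  ∎
    where
    same-root-perm : proj₁ (remQuot {d !} (autCount k ^ d) c) ≡ proj₁ (remQuot {d !} (autCount k ^ d) c′)
    same-root-perm = perm-injective d _ _ (λ a → proj₁ (∷-injective (same (a ∷ root))))
    same-branches : proj₂ (remQuot {d !} (autCount k ^ d) c) ≡ proj₂ (remQuot {d !} (autCount k ^ d) c′)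
    same-branches = finToFun-injective (autCount k) d _ _ λ a →
      aut-injective (branch {k} c a) (branch {k} c′ a) (λ w → proj₂ (∷-injective (same (a ∷ w))))

  aut-isAut : ∀ {k} (c : Fin (autCount k)) → IsAut (aut {k} c)
  aut-isAut c = aut⁻¹ c , aut⁻¹-aut c , aut-aut⁻¹ c , λ x y →
    aut-child c , λ xy → subst₂ Child (aut⁻¹-aut c x) (aut⁻¹-aut c y) (aut⁻¹-child c xy)

  aut⁻¹-isAut : ∀ {k} (c : Fin (autCount k)) → IsAut (aut⁻¹ {k} c)
  aut⁻¹-isAut c = aut c , aut-aut⁻¹ c , aut⁻¹-aut c , λ x y →
    aut⁻¹-child c , λ xy → subst₂ Child (aut-aut⁻¹ c x) (aut-aut⁻¹ c y) (aut-child c xy)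

  ∘-isAut : ∀ {k} {f g : Vert d k → Vert d k} → IsAut f → IsAut g → IsAut (λ x → f (g x))
  ∘-isAut {f = f} {g} (f⁻¹ , f⁻¹f , ff⁻¹ , f-child) (g⁻¹ , g⁻¹g , gg⁻¹ , g-child) =
    (λ x → g⁻¹ (f⁻¹ x)) ,
    (λ x → trans (cong g⁻¹ (f⁻¹f (g x))) (g⁻¹g x)) ,
    (λ x → trans (cong f (gg⁻¹ (f⁻¹ x))) (ff⁻¹ x)) ,
    λ x y → (λ xy → proj₁ (f-child (g x) (g y)) (proj₁ (g-child x y) xy)) ,
            (λ xy → proj₂ (g-child x y) (proj₂ (f-child (g x) (g y)) xy))

  -- The root is the only vertex without a parent.
  isAut-root : ∀ {k} {f : Vert d k → Vert d k} → IsAut f → f root ≡ root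
  isAut-root {f = f} (f⁻¹ , _ , ff⁻¹ , f-child) with f root in f-root
  ... | root  = refl
  ... | a ∷ w with p , p-child ← parent-exists a w =
    ⊥-elim (root-parentless (proj₂ (f-child (f⁻¹ p) root) (subst₂ Child (sym (ff⁻¹ p)) (sym f-root) p-child)))

  ParentClosed : ∀ {k} → VSet d k → Set
  ParentClosed {k} A = ∀ (x y : Vert d k) → Child x y → y ∈ A → x ∈ A

  record RootedEmbedding {k} (A : VSet d k) (h : Vert d k → Vert d k) : Set where
    field
      root↦root   : root ∈ A → h root ≡ root
      injective   : ∀ {x y} → x ∈ A → y ∈ A → h x ≡ h y → x ≡ y
      child↦child : ∀ {x y} → x ∈ A → y ∈ A → Child x y → Child (h x) (h y)

  -- How a rooted embedding of a parent-closed subset of T_(k+1) acts on the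
  -- children of the root (ρ) and on the branch below each child.
  module Branches {k} {A : VSet d (suc k)} {h} (closed : ParentClosed A) (E : RootedEmbedding A h) where
    open RootedEmbedding E

    branch-root∈ : ∀ {a w} → (a ∷ w) ∈ A → (a ∷ root) ∈ A
    branch-root∈ {a} {w} = path-induction (λ u → (a ∷ u) ∈ A → (a ∷ root) ∈ A) (λ a∈A → a∈A)
      (λ xy IH ay∈A → IH (closed _ _ (step a xy) ay∈A)) w

    image-of-child : ∀ {a} → (a ∷ root) ∈ A → ∃ λ b → h (a ∷ root) ≡ b ∷ root
    image-of-child {a} a∈A with root∈A ← closed _ _ (top a) a∈A =
      child-root (subst (λ r → Child r (h (a ∷ root))) (root↦root root∈A) (child↦child root∈A a∈A (top a)))

    ρ-at : ∀ a {m} → A (a ∷ root) ≡ m → Maybe (Fin d)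
    ρ-at a {true}  a∈A = just (proj₁ (image-of-child a∈A))
    ρ-at a {false} _   = nothing

    ρ : Fin d → Maybe (Fin d)
    ρ a = ρ-at a refl

    ρ-at-just : ∀ {a b m} (a∈?A : A (a ∷ root) ≡ m) → ρ-at a a∈?A ≡ just b → (a ∷ root) ∈ A × h (a ∷ root) ≡ b ∷ root
    ρ-at-just {m = true} a∈A refl = a∈A , proj₂ (image-of-child a∈A)

    ρ-just : ∀ {a b} → ρ a ≡ just b → (a ∷ root) ∈ A × h (a ∷ root) ≡ b ∷ root
    ρ-just = ρ-at-just refl

    ρ-at-defined : ∀ {a m} (a∈?A : A (a ∷ root) ≡ m) → (a ∷ root) ∈ A → ∃ λ b → ρ-at a a∈?A ≡ just b
    ρ-at-defined {m = true}  _    _   = _ , refl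
    ρ-at-defined {m = false} a∉A a∈A with () ← trans (sym a∈A) a∉A

    ρ-defined : ∀ {a w} → (a ∷ w) ∈ A → ∃ λ b → ρ a ≡ just b
    ρ-defined aw∈A = ρ-at-defined refl (branch-root∈ aw∈A)

    ρ-injective : PartialInjection ρ
    ρ-injective ρa≡b ρa′≡b with a∈A , ha≡b ← ρ-just ρa≡b | a′∈A , ha′≡b ← ρ-just ρa′≡b =
      proj₁ (∷-injective (injective a∈A a′∈A (trans ha≡b (sym ha′≡b))))

    stays-in-branch : ∀ {a b} → ρ a ≡ just b → ∀ {w} → (a ∷ w) ∈ A → h (a ∷ w) ≡ b ∷ tail (h (a ∷ w))
    stays-in-branch {a} {b} ρa≡b {w} = path-induction (λ u → (a ∷ u) ∈ A → h (a ∷ u) ≡ b ∷ tail (h (a ∷ u)))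
      (λ _ → trans ha≡b (cong (λ z → b ∷ tail z) (sym ha≡b)))
      (λ {x} {y} xy IH ay∈A → let ax∈A = closed _ _ (step a xy) ay∈A in
        child-branch (subst (λ z → Child z (h (a ∷ y))) (IH ax∈A) (child↦child ax∈A ay∈A (step a xy)))) w
      where ha≡b = proj₂ (ρ-just ρa≡b)

    branch-embedding : ∀ a → RootedEmbedding (λ w → A (a ∷ w)) (λ w → tail (h (a ∷ w)))
    branch-embedding a = record
      { root↦root   = λ a∈A → cong tail (proj₂ (ρ-just (proj₂ (ρ-defined a∈A))))
      ; injective   = λ {x} {y} ax∈A ay∈A same →
          let b , ρa≡b = ρ-defined ax∈A in
          proj₂ (∷-injective (injective ax∈A ay∈A (begin
            h (a ∷ x)            ≡⟨ stays-in-branch ρa≡b ax∈A ⟩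
            b ∷ tail (h (a ∷ x)) ≡⟨ cong (b ∷_) same ⟩
            b ∷ tail (h (a ∷ y)) ≡⟨ stays-in-branch ρa≡b ay∈A ⟨
            h (a ∷ y)            ∎)))
      ; child↦child = λ ax∈A ay∈A xy →
          let b , ρa≡b = ρ-defined ax∈A in
          child-tail (subst₂ Child (stays-in-branch ρa≡b ax∈A) (stays-in-branch ρa≡b ay∈A)
            (child↦child ax∈A ay∈A (step a xy))) }

  extend : ∀ {k} {A : VSet d k} {h} → ParentClosed A → RootedEmbedding A h →
    ∃ λ (c : Fin (autCount k)) → ∀ {x} → x ∈ A → aut c x ≡ h x
  extend {zero} _ E = zero , λ { {root} root∈A → sym (RootedEmbedding.root↦root E root∈A) }
  extend {suc k} {A} {h} closed E = encode {k} p q , agrees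
    where
    open RootedEmbedding E
    open Branches closed E

    p : Fin (d !)
    p = proj₁ (perm-extends d ρ ρ-injective)

    branch-extension : ∀ a → ∃ λ (c : Fin (autCount k)) → ∀ {w} → (a ∷ w) ∈ A → aut c w ≡ tail (h (a ∷ w))
    branch-extension a = extend (λ x y xy → closed _ _ (step a xy)) (branch-embedding a)

    q : Fin d → Fin (autCount k)
    q a = proj₁ (branch-extension a)

    agrees : ∀ {x} → x ∈ A → aut (encode {k} p q) x ≡ h x
    agrees {root}  root∈A = sym (root↦root root∈A)
    agrees {a ∷ w} aw∈A with b , ρa≡b ← ρ-defined aw∈A = begin
      aut (encode {k} p q) (a ∷ w)    ≡⟨ aut-encode p q a w ⟩
      (perm d p ⟨$⟩ʳ a) ∷ aut (q a) w ≡⟨ cong₂ _∷_ (proj₂ (perm-extends d ρ ρ-injective) ρa≡b) (proj₂ (branch-extension a) aw∈A) ⟩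
      b ∷ tail (h (a ∷ w))            ≡⟨ stays-in-branch ρa≡b aw∈A ⟨
      h (a ∷ w)                       ∎

  iso⁻¹-embedding : ∀ {k} {A B : VSet d k} (iso : RootedIso A B) → root ∈ A → RootedEmbedding B (proj₁ (proj₂ iso))
  iso⁻¹-embedding (h , g , h-into , g-into , gh , hg , h-root , h-child) root∈A = record
    { root↦root   = λ _ → trans (cong g (sym h-root)) (gh root root∈A)
    ; injective   = λ {x} {y} x∈ y∈ same → trans (sym (hg x x∈)) (trans (cong h same) (hg y y∈))
    ; child↦child = λ {x} {y} x∈ y∈ xy →
        proj₂ (h-child (g x) (g y) (g-into x x∈) (g-into y y∈)) (subst₂ Child (sym (hg x x∈)) (sym (hg y y∈)) xy) }

  isAut⇒aut : ∀ {k} {f : Vert d k → Vert d k} → IsAut f → ∃ λ (c : Fin (autCount k)) → ∀ x → f x ≡ aut c x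
  isAut⇒aut {f = f} f-isAut@(f⁻¹ , f⁻¹f , _ , f-child)
    with c , agrees ← extend {A = λ _ → true} (λ _ _ _ _ → refl) record
      { root↦root   = λ _ → isAut-root f-isAut
      ; injective   = λ {x} {y} _ _ same → trans (sym (f⁻¹f x)) (trans (cong f⁻¹ same) (f⁻¹f y))
      ; child↦child = λ {x} {y} _ _ → proj₁ (f-child x y) }
    = c , λ x → sym (agrees refl)

  geom-suc : ∀ k → suc (geom d k * d) ≡ geom d (suc k)
  geom-suc zero    = refl
  geom-suc (suc k) = begin
    suc ((geom d k + d ^ k) * d)       ≡⟨ cong suc (ℕ.*-distribʳ-+ d (geom d k) (d ^ k)) ⟩
    suc (geom d k * d) + d ^ k * d     ≡⟨ cong (_+ d ^ k * d) (geom-suc k) ⟩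
    geom d k + d ^ k + d ^ k * d       ≡⟨ cong (geom d k + d ^ k +_) (ℕ.*-comm (d ^ k) d) ⟩
    geom d (suc k) + d ^ suc k         ∎

  autCount≡ : ∀ k → autCount k ≡ (d !) ^ geom d k
  autCount≡ zero    = refl
  autCount≡ (suc k) = begin
    d ! * autCount k ^ d          ≡⟨ cong (λ n → d ! * n ^ d) (autCount≡ k) ⟩
    d ! * ((d !) ^ geom d k) ^ d  ≡⟨ cong (d ! *_) (ℕ.^-*-assoc (d !) (geom d k) d) ⟩
    (d !) ^ suc (geom d k * d)    ≡⟨ cong ((d !) ^_) (geom-suc k) ⟩
    (d !) ^ geom d (suc k)        ∎

module _ {d k : ℕ} where
  open Tree d

  private variable
    x y x′ y′ : Vert d k
    A B : VSet d k
    σ τ : PMap d k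

  _⊆_ : VSet d k → VSet d k → Set
  A ⊆ B = ∀ x → x ∈ A → x ∈ B

  _≐_ : VSet d k → VSet d k → Set
  A ≐ B = ∀ x → A x ≡ B x

  ⊆-antisym : A ⊆ B → B ⊆ A → A ≐ B
  ⊆-antisym {A} {B} A⊆B B⊆A x with A x in Ax | B x in Bx
  ... | true  | true  = refl
  ... | false | false = refl
  ... | true  | false = trans (sym (A⊆B x Ax)) Bx
  ... | false | true  = trans (sym Ax) (B⊆A x Bx)

  is-just⇒just : ∀ {m : Maybe (Vert d k)} → is-just m ≡ true → ∃ λ y → m ≡ just y
  is-just⇒just {just y} _ = y , refl

  is-just≡false : ∀ {m : Maybe (Vert d k)} → is-just m ≡ false → m ≡ nothing
  is-just≡false {nothing} _ = refl

  idOn : VSet d k → PMap d k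
  idOn A x = if A x then just x else nothing

  dom-idOn : ∀ A → dom (idOn A) ≐ A
  dom-idOn A x with A x
  ... | true  = refl
  ... | false = refl

  idOn-∈ : x ∈ A → idOn A x ≡ just x
  idOn-∈ x∈A rewrite x∈A = refl

  idOn-just : idOn A x ≡ just y → x ≡ y × x ∈ A
  idOn-just {A} {x} e with A x
  idOn-just refl | true = refl , refl

  idOn-isPAutc : IsSubtree A → IsPAutc (idOn A)
  idOn-isPAutc {A} (root∈A , closed) =
    (trans (dom-idOn A root) root∈A , λ x y xy y∈ → trans (dom-idOn A x) (closed x y xy (trans (sym (dom-idOn A y)) y∈))) ,
    (λ x y z x↦z y↦z → trans (proj₁ (idOn-just {A = A} x↦z)) (sym (proj₁ (idOn-just {A = A} y↦z)))) ,
    (λ x y x↦y → cong level (sym (proj₁ (idOn-just {A = A} x↦y)))) ,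
    λ x y x′ y′ x↦x′ y↦y′ → let x≡x′ = proj₁ (idOn-just {A = A} x↦x′) ; y≡y′ = proj₁ (idOn-just {A = A} y↦y′) in
      subst₂ Adj x≡x′ y≡y′ , subst₂ Adj (sym x≡x′) (sym y≡y′)

  inverse : PMap d k → PMap d k
  inverse σ y with any-vertex? (λ x → ≡-dec _≟ᵥ_ (σ x) (just y))
  ... | yes (x , _) = just x
  ... | no  _       = nothing

  ran : PMap d k → VSet d k
  ran σ = dom (inverse σ)

  inverse-just : inverse σ y ≡ just x → σ x ≡ just y
  inverse-just {σ} {y} e with any-vertex? (λ x → ≡-dec _≟ᵥ_ (σ x) (just y))
  inverse-just refl | yes (x , σx≡y) = σx≡y

  inverse-defined : σ x ≡ just y → ∃ λ x′ → inverse σ y ≡ just x′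
  inverse-defined {σ} {x} {y} σx≡y with any-vertex? (λ x → ≡-dec _≟ᵥ_ (σ x) (just y))
  ... | yes (x′ , _) = x′ , refl
  ... | no  none     = ⊥-elim (none (x , σx≡y))

  ∈-ran : σ x ≡ just y → y ∈ ran σ
  ∈-ran σx≡y with x′ , e ← inverse-defined σx≡y = cong is-just e

  module _ (σ-isPAutc : IsPAutc σ) where
    private
      dom-subtree = proj₁ σ-isPAutc
      σ-injective = proj₁ (proj₂ σ-isPAutc)
      σ-level     = proj₁ (proj₂ (proj₂ σ-isPAutc))
      σ-adj       = proj₂ (proj₂ (proj₂ σ-isPAutc))

    inverse-complete : σ x ≡ just y → inverse σ y ≡ just x
    inverse-complete σx≡y with x′ , e ← inverse-defined σx≡y =
      trans e (cong just (σ-injective _ _ _ (inverse-just e) σx≡y))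

    -- Adjacency plus the level shift singles out the parent-child orientation.
    σ-child : σ x ≡ just x′ → σ y ≡ just y′ → Child x y → Child x′ y′
    σ-child {x} {x′} {y} {y′} σx σy xy = adj⇒child (proj₁ (σ-adj x y x′ y′ σx σy) (inj₁ xy))
      (trans (σ-level y y′ σy) (trans (child-level xy) (cong suc (sym (σ-level x x′ σx)))))

    σ-root : σ root ≡ just root
    σ-root with r , σr ← is-just⇒just (proj₁ dom-subtree) = trans σr (cong just (level≡0 (σ-level root r σr)))

    inverse-isPAutc : IsPAutc (inverse σ)
    inverse-isPAutc =
      (cong is-just (inverse-complete σ-root) , closed) ,
      (λ y y′ x e e′ → just-injective (trans (sym (inverse-just e)) (inverse-just e′))) ,
      (λ y x e → sym (σ-level x y (inverse-just e))) ,
      λ y y′ x x′ e e′ → swap (σ-adj x x′ y y′ (inverse-just e) (inverse-just e′))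
      where
      closed : ParentClosed (ran σ)
      closed x y xy y∈ran with x₀ , e ← is-just⇒just y∈ran
        with p , px₀ ← has-parent (trans (sym (σ-level x₀ y (inverse-just e))) (child-level xy))
        with p′ , σp ← is-just⇒just (proj₂ dom-subtree p x₀ px₀ (cong is-just (inverse-just e)))
        rewrite parent-unique xy (σ-child σp (inverse-just e) px₀) = ∈-ran σp

  -- GreenR σ τ and GreenL σ τ unfold to σ ≤R τ × τ ≤R σ and σ ≤L τ × τ ≤L σ.
  _≤R_ : PMap d k → PMap d k → Set
  σ ≤R τ = σ ≈ τ ⊎ Σ (PMap d k) (λ α → IsPAutc α × σ ≈ (τ · α))

  _≤L_ : PMap d k → PMap d k → Set
  σ ≤L τ = σ ≈ τ ⊎ Σ (PMap d k) (λ α → IsPAutc α × σ ≈ (α · τ))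

  ≤R-dom : σ ≤R τ → dom σ ⊆ dom τ
  ≤R-dom (inj₁ σ≈τ)           x x∈ = trans (cong is-just (sym (σ≈τ x))) x∈
  ≤R-dom {τ = τ} (inj₂ (α , _ , σ≈τα)) x x∈ with τ x | σ≈τα x
  ... | just _ | _ = refl
  ... | nothing | σx≡nothing rewrite σx≡nothing = x∈

  ≤L-ran : σ ≤L τ → σ x ≡ just y → ∃ λ z → τ z ≡ just y
  ≤L-ran {x = x} (inj₁ σ≈τ)          σx≡y = x , trans (sym (σ≈τ x)) σx≡y
  ≤L-ran {x = x} (inj₂ (α , _ , σ≈ατ)) σx≡y with z , αx≡z , τz≡y ← >>=-just (α x) (trans (sym (σ≈ατ x)) σx≡y) = z , τz≡y

  R-idOn⇒≐ : GreenR (idOn A) (idOn B) → A ≐ B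
  R-idOn⇒≐ {A} {B} (A≤B , B≤A) = ⊆-antisym
    (λ x x∈A → trans (sym (dom-idOn B x)) (≤R-dom A≤B x (trans (dom-idOn A x) x∈A)))
    (λ x x∈B → trans (sym (dom-idOn A x)) (≤R-dom B≤A x (trans (dom-idOn B x) x∈B)))

  L-idOn⇒≐ : GreenL (idOn A) (idOn B) → A ≐ B
  L-idOn⇒≐ {A} {B} (A≤B , B≤A) = ⊆-antisym (ran-⊆ A≤B) (ran-⊆ B≤A)
    where
    ran-⊆ : ∀ {A B} → idOn A ≤L idOn B → A ⊆ B
    ran-⊆ {A} {B} A≤B y y∈A with z , z↦y ← ≤L-ran A≤B (idOn-∈ {A = A} y∈A) with refl , z∈B ← idOn-just {A = B} z↦y = z∈B

  module _ (σ-isPAutc : IsPAutc σ) where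

    R-idOn-dom : A ≐ dom σ → GreenR σ (idOn A)
    R-idOn-dom {A} A≐dom = inj₂ (σ , σ-isPAutc , σ≈idOn·σ) , inj₂ (inverse σ , inverse-isPAutc σ-isPAutc , idOn≈σ·σ⁻¹)
      where
      σ≈idOn·σ : σ ≈ (idOn A · σ)
      σ≈idOn·σ x with A x in Ax
      ... | true  = refl
      ... | false = is-just≡false (trans (sym (A≐dom x)) Ax)
      idOn≈σ·σ⁻¹ : idOn A ≈ (σ · inverse σ)
      idOn≈σ·σ⁻¹ x with A x in Ax
      ... | true  with y , σx≡y ← is-just⇒just (trans (sym (A≐dom x)) Ax) rewrite σx≡y =
        sym (inverse-complete σ-isPAutc σx≡y)
      ... | false rewrite is-just≡false (trans (sym (A≐dom x)) Ax) = refl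

    L-idOn-ran : A ≐ ran σ → GreenL σ (idOn A)
    L-idOn-ran {A} A≐ran = inj₂ (σ , σ-isPAutc , σ≈σ·idOn) , inj₂ (inverse σ , inverse-isPAutc σ-isPAutc , idOn≈σ⁻¹·σ)
      where
      σ≈σ·idOn : σ ≈ (σ · idOn A)
      σ≈σ·idOn x with σ x in σx
      ... | just y  = sym (idOn-∈ {A = A} (trans (A≐ran y) (∈-ran σx)))
      ... | nothing = refl
      idOn≈σ⁻¹·σ : idOn A ≈ (inverse σ · σ)
      idOn≈σ⁻¹·σ y with A y in Ay
      ... | true  with x , e ← is-just⇒just (trans (sym (A≐ran y)) Ay) rewrite e = sym (inverse-just e)
      ... | false rewrite is-just≡false (trans (sym (A≐ran y)) Ay) = refl

module Orbits (d k : ℕ) (Γ : VSet d k) (Γ-subtree : IsSubtree Γ) where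
  open Tree d hiding (aut; aut⁻¹)

  N : ℕ
  N = autCount k

  aut aut⁻¹ : Fin N → Vert d k → Vert d k
  aut   = Tree.aut d
  aut⁻¹ = Tree.aut⁻¹ d

  orbit : Fin N → VSet d k
  orbit c y = Γ (aut⁻¹ c y)

  _~_ : Rel (Fin N) 0ℓ
  c ~ c′ = orbit c ≐ orbit c′

  ~-isDecEquivalence : IsDecEquivalence _~_
  ~-isDecEquivalence = record
    { isEquivalence = record
      { refl  = λ _ → refl
      ; sym   = λ e y → sym (e y)
      ; trans = λ e e′ y → trans (e y) (e′ y) }
    ; _≟_ = λ c c′ → all-vertices? (λ y → orbit c y Bool.≟ orbit c′ y) }

  n : ℕ
  n = proj₁ (count-classes ~-isDecEquivalence)

  orbits : Count U _~_ n
  orbits = proj₂ (count-classes ~-isDecEquivalence)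

  Stabilizes : Pred (Fin N) 0ℓ
  Stabilizes c = ∀ x → Γ (aut c x) ≡ Γ x

  stabilizes? : Decidable Stabilizes
  stabilizes? c = all-vertices? (λ x → Γ (aut c x) Bool.≟ Γ x)

  m : ℕ
  m = proj₁ (count-decidable stabilizes?)

  stabilizers : Count Stabilizes _≡_ m
  stabilizers = proj₂ (count-decidable stabilizes?)

  count-Stab : Count (Stab Γ) _≗_ m
  count-Stab = record
    { rep          = λ s → aut (rep stabilizers s)
    ; rep-in       = λ s → aut-isAut _ , rep-in stabilizers s
    ; rep-distinct = λ s s′ same → rep-distinct stabilizers s s′ (aut-injective _ _ same)
    ; rep-cover    = cover }
    where
    cover : ∀ f → Stab Γ f → Σ (Fin m) λ s → f ≗ aut (rep stabilizers s)
    cover f (f-isAut , f-stab) with c , f≗c ← isAut⇒aut f-isAut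
      with s , refl ← rep-cover stabilizers c (λ x → trans (cong Γ (sym (f≗c x))) (f-stab x)) = s , f≗c

  count-IsAut : Count IsAut _≗_ N
  count-IsAut = record
    { rep = aut ; rep-in = aut-isAut ; rep-distinct = aut-injective ; rep-cover = λ f → isAut⇒aut }

  composite-orbit : ∀ c s → Stabilizes s → ∀ x → orbit c (aut c (aut s x)) ≡ Γ x
  composite-orbit c s s-stab x = trans (cong Γ (aut⁻¹-aut c (aut s x))) (s-stab x)

  composite-~ : ∀ {c c′ s s′} → Stabilizes s → Stabilizes s′ →
    (∀ x → aut c (aut s x) ≡ aut c′ (aut s′ x)) → c ~ c′
  composite-~ {c} {c′} {s} {s′} s-stab s′-stab same y = begin
    orbit c y                    ≡⟨ cong (orbit c) y≡ ⟨
    orbit c (aut c (aut s x))    ≡⟨ composite-orbit c s s-stab x ⟩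
    Γ x                          ≡⟨ composite-orbit c′ s′ s′-stab x ⟨
    orbit c′ (aut c′ (aut s′ x)) ≡⟨ cong (orbit c′) (trans (sym (same x)) y≡) ⟩
    orbit c′ y                   ∎
    where
    x = aut⁻¹ s (aut⁻¹ c y)
    y≡ : aut c (aut s x) ≡ y
    y≡ = trans (cong (aut c) (aut-aut⁻¹ s _)) (aut-aut⁻¹ c y)

  stabilizer-part : ∀ {f c r b} → f ≗ aut c → c ~ r → (∀ x → aut⁻¹ r (f x) ≡ aut b x) → Stabilizes b
  stabilizer-part {f} {c} {r} {b} f≗c c~r r⁻¹f≗b x = begin
    Γ (aut b x)           ≡⟨ cong Γ (r⁻¹f≗b x) ⟨
    orbit r (f x)         ≡⟨ c~r (f x) ⟨
    orbit c (f x)         ≡⟨ cong (orbit c) (f≗c x) ⟩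
    Γ (aut⁻¹ c (aut c x)) ≡⟨ cong Γ (aut⁻¹-aut c x) ⟩
    Γ x                   ∎

  -- Every automorphism is uniquely (orbit representative) ∘ (stabilizer element).
  count-composites : Count IsAut _≗_ (n * m)
  count-composites = count-pairs composite (λ t u → ∘-isAut (aut-isAut _) (aut-isAut _)) distinct cover
    where
    composite : Fin n → Fin m → Vert d k → Vert d k
    composite t u x = aut (rep orbits t) (aut (rep stabilizers u) x)

    distinct : ∀ t u t′ u′ → composite t u ≗ composite t′ u′ → t ≡ t′ × u ≡ u′
    distinct t u t′ u′ same with refl ← rep-distinct orbits t t′
      (composite-~ (rep-in stabilizers u) (rep-in stabilizers u′) same) =
      refl , rep-distinct stabilizers u u′ (aut-injective _ _ λ x →
        trans (sym (aut⁻¹-aut c (aut _ x))) (trans (cong (aut⁻¹ c) (same x)) (aut⁻¹-aut c (aut _ x))))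
      where c = rep orbits t

    cover : ∀ f → IsAut f → ∃₂ λ t u → f ≗ composite t u
    cover f f-isAut
      with c , f≗c ← isAut⇒aut f-isAut
      with t , c~r ← rep-cover orbits c _
      with b , r⁻¹f≗b ← isAut⇒aut (∘-isAut (aut⁻¹-isAut (rep orbits t)) f-isAut)
      with u , refl ← rep-cover stabilizers b (stabilizer-part f≗c c~r r⁻¹f≗b) =
      t , u , λ x → trans (sym (aut-aut⁻¹ (rep orbits t) (f x))) (cong (aut (rep orbits t)) (r⁻¹f≗b x))

  orbit-stabilizer : n * m ≡ N
  orbit-stabilizer = count-unique (λ e x → sym (e x)) (λ e e′ x → trans (e x) (e′ x)) count-composites count-IsAut

  orbit-isSubtree : ∀ c → IsSubtree (orbit c)
  orbit-isSubtree c = proj₁ Γ-subtree , λ x y xy y∈ → proj₂ Γ-subtree _ _ (aut⁻¹-child c xy) y∈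

  idOn-orbit∈D : ∀ c → DClass Γ (idOn (orbit c))
  idOn-orbit∈D c = idOn-isPAutc (orbit-isSubtree c) ,
    aut⁻¹ c , aut c ,
    (λ x x∈ → trans (sym (dom-idOn (orbit c) x)) x∈) ,
    (λ y y∈ → trans (dom-idOn (orbit c) (aut c y)) (trans (cong Γ (aut⁻¹-aut c y)) y∈)) ,
    (λ x _ → aut-aut⁻¹ c x) ,
    (λ y _ → aut⁻¹-aut c y) ,
    refl ,
    λ x y _ _ → proj₂ (proj₂ (proj₂ (aut⁻¹-isAut c))) x y

  image-is-orbit : ∀ {B h} → RootedEmbedding Γ h →
    (∀ x → x ∈ Γ → h x ∈ B) → (∀ y → y ∈ B → ∃ λ x → x ∈ Γ × h x ≡ y) → ∃ λ c → B ≐ orbit c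
  image-is-orbit {B} {h} E h-into h-onto with c , agrees ← extend (proj₂ Γ-subtree) E = c , ⊆-antisym B⊆orbit orbit⊆B
    where
    B⊆orbit : B ⊆ orbit c
    B⊆orbit y y∈B with x , x∈Γ , refl ← h-onto y y∈B = subst (_∈ Γ) (sym (trans (cong (aut⁻¹ c) (sym (agrees x∈Γ))) (aut⁻¹-aut c x))) x∈Γ
    orbit⊆B : orbit c ⊆ B
    orbit⊆B y y∈orbit = subst (_∈ B) (trans (sym (agrees y∈orbit)) (aut-aut⁻¹ c y)) (h-into _ y∈orbit)

  dom-is-orbit : ∀ {σ} → DClass Γ σ → ∃ λ c → dom σ ≐ orbit c
  dom-is-orbit (σ-isPAutc , iso@(h , g , h-into , g-into , gh , _)) =
    image-is-orbit (iso⁻¹-embedding iso (proj₁ (proj₁ σ-isPAutc))) g-into (λ y y∈ → h y , h-into y y∈ , gh y y∈)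

  ran-is-orbit : ∀ {σ} → DClass Γ σ → ∃ λ c → ran σ ≐ orbit c
  ran-is-orbit {σ} (σ-isPAutc , iso@(h , g , h-into , g-into , gh , _)) = image-is-orbit E φ-into φ-onto
    where
    open RootedEmbedding (iso⁻¹-embedding iso (proj₁ (proj₁ σ-isPAutc)))
    φ : Vert d k → Vert d k
    φ x = fromMaybe x (σ (g x))
    σg≡φ : ∀ {x} → x ∈ Γ → σ (g x) ≡ just (φ x)
    σg≡φ {x} x∈ with y , e ← is-just⇒just (g-into x x∈) = trans e (cong just (sym (cong (fromMaybe x) e)))
    E : RootedEmbedding Γ φ
    E = record
      { root↦root   = λ root∈ → cong (fromMaybe root) (trans (cong σ (root↦root root∈)) (σ-root σ-isPAutc))
      ; injective   = λ x∈ y∈ same → injective x∈ y∈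
          (proj₁ (proj₂ σ-isPAutc) _ _ _ (σg≡φ x∈) (trans (σg≡φ y∈) (cong just (sym same))))
      ; child↦child = λ x∈ y∈ xy → σ-child σ-isPAutc (σg≡φ x∈) (σg≡φ y∈) (child↦child x∈ y∈ xy) }
    φ-into : ∀ x → x ∈ Γ → φ x ∈ ran σ
    φ-into x x∈ = ∈-ran (σg≡φ x∈)
    φ-onto : ∀ y → y ∈ ran σ → ∃ λ x → x ∈ Γ × φ x ≡ y
    φ-onto y y∈ with x₀ , e ← is-just⇒just y∈ with σx₀ ← inverse-just e =
      h x₀ , h-into x₀ x₀∈ , just-injective (trans (sym (σg≡φ (h-into x₀ x₀∈))) (trans (cong σ (gh x₀ x₀∈)) σx₀))
      where x₀∈ = cong is-just σx₀

  count-by-orbits : ∀ {G : PMap d k → PMap d k → Set} (S : PMap d k → VSet d k) →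
    (∀ {A B} → G (idOn A) (idOn B) → A ≐ B) →
    (∀ {σ} → DClass Γ σ → ∃ λ c → S σ ≐ orbit c) →
    (∀ {σ A} → IsPAutc σ → A ≐ S σ → G σ (idOn A)) →
    Count (DClass Γ) G n
  count-by-orbits {G} S G-idOn⇒≐ S-orbit G-idOn = record
    { rep          = λ t → idOn (orbit (rep orbits t))
    ; rep-in       = λ t → idOn-orbit∈D _
    ; rep-distinct = λ t t′ G-tt′ → rep-distinct orbits t t′ (G-idOn⇒≐ G-tt′)
    ; rep-cover    = cover }
    where
    cover : ∀ σ → DClass Γ σ → Σ (Fin n) λ t → G σ (idOn (orbit (rep orbits t)))
    cover σ σ∈D with c , S≐c ← S-orbit σ∈D with t , c~r ← rep-cover orbits c _ =
      t , G-idOn (proj₁ σ∈D) (λ x → sym (trans (S≐c x) (c~r x)))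

  count-R : Count (DClass Γ) GreenR n
  count-R = count-by-orbits dom R-idOn⇒≐ dom-is-orbit (λ σ-isPAutc → R-idOn-dom σ-isPAutc)

  count-L : Count (DClass Γ) GreenL n
  count-L = count-by-orbits ran L-idOn⇒≐ ran-is-orbit (λ σ-isPAutc → L-idOn-ran σ-isPAutc)

mainTheorem11 : (d k : ℕ) → 2 ≤ d → 1 ≤ k → (Γ : VSet d k) → IsSubtree Γ →
    Σ ℕ λ n → Σ ℕ λ m →
      Count (DClass Γ) GreenR n × Count (DClass Γ) GreenL n ×
      Count (Stab Γ) _≗_ m × n * m ≡ (d !) ^ geom d k
mainTheorem11 d k _ _ Γ Γ-subtree =
  n , m , count-R , count-L , count-Stab , trans orbit-stabilizer (Tree.autCount≡ d k)
  where open Orbits d k Γ Γ-subtree
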